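{- The canonical model $\mathcal M^c=(\mathcal W^c,\mathcal R^c,\mathcal E^c,\mathcal V^c)$ is an $\mathsf{RPLJ}_{\mathsf{CS}}$-model; that is, for every $S\in\mathcal W^c$, all terms $s,t$, all formulas $A,B$: $\mathcal E^c_S(s,A\to B)*_L\mathcal E^c_S(t,A)\le\mathcal E^c_S(s\cdot t,B)$; $\mathcal E^c_S(s,A)\le\mathcal E^c_S(t+s,A)$ and $\mathcal E^c_S(s,A)\le\mathcal E^c_S(s+t,A)$; and $\mathcal E^c_S(c,F)=1$ whenever $c\overset{1}{:}F\in\mathsf{CS}$.
   Context: Justification terms are built from justification variables $x_1,x_2,\dots$ and justification constants $c,c_1,c_2,\dots$ by binary operations $\cdot$ and $+$; $Tm$ is the set of terms. Formulas of $\mathsf{RPLJ}$: $A::=p\mid\bar r\mid A\&A\mid A\to A\mid t:A$ ($p$ a propositional variable, $r\in\mathbb Q\cap[0,1]$, $t\in Tm$). Abbreviations: $\neg A:=A\to\bar0$, $A\wedge B:=A\&(A\to B)$, $A\equiv B:=(A\to B)\&(B\to A)$, $t\overset{r}{:}A:=(\bar r\to t:A)\wedge(t:A\to\bar r)$. On $[0,1]$: $x*_Ly=\max(0,x+y-1)$, $x\Rightarrow_Ly=\min(1,1-x+y)$. Axiom schemes of $\mathsf{RPLJ}$: (BL1) $(A\to B)\to((B\to C)\to(A\to C))$; (BL2) $(A\&B)\to A$; (BL3) $(A\&B)\to(B\&A)$; (BL4) $(A\&(A\to B))\to(B\&(B\to A))$; (BL5a) $(A\to(B\to C))\to((A\&B)\to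 C)$; (BL5b) $((A\&B)\to C)\to(A\to(B\to C))$; (BL6) $((A\to B)\to C)\to(((B\to A)\to C)\to C)$; (BL7) $\bar0\to A$; (L) $\neg\neg A\to A$; (TC1) $(\bar r\to\bar{r'})\equiv\overline{r\Rightarrow_Lr'}$; (TC2) $(\bar r\&\bar{r'})\equiv\overline{r*_Lr'}$; (Appl) $s:(A\to B)\to(t:A\to(s\cdot t):B)$; (Sum) $s:A\to(s+t):A$, $s:A\to(t+s):A$. $\mathsf{CS}$ is a constant specification: a downward closed set of formulas $c_{i_n}\overset{1}{:}\cdots\overset{1}{:}c_{i_1}\overset{1}{:}A$ ($n\ge1$, $c_{i_j}$ constants, $A$ an axiom instance) (with such a formula, $n\ge2$, it contains $c_{i_{n-1}}\overset1:\cdots\overset1:c_{i_1}\overset1:A$). $\mathsf{RPLJ}_{\mathsf{CS}}$: the axioms above, Modus Ponens, and "derive any member of $\mathsf{CS}$"; $S\vdash_{\mathsf{CS}}A$: $A$ derivable in $\mathsf{RPLJ}_{\mathsf{CS}}$ with members of $S$ as additional premises. $S$ is $\mathsf{CS}$-consistent if $S\not\vdash_{\mathsf{CS}}\bar0$, and $\mathsf{CS}$-complete if for all $A,B$, $S\vdash_{\mathsf{CS}}A\to B$ or $S\vdash_{\mathsf{CS}}B\to A$. Provability degree: $|A|^{\mathsf{CS}}_S:=\sup\{r\in\mathbb Q\cap[0,1]:S\vdash_{\mathsf{CS}}\bar r\to A\}$. Canonical model: $\mathcal W^c$ = the set of all $\mathsf{CS}$-consistent, $\mathsf{CS}$-complete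 sets of formulas; $S_1\mathcal R^cS_2$ iff $\{A:t:A\in S_1\text{ for some }t\}\subseteq S_2$; $\mathcal E^c_S(t,A):=|t:A|^{\mathsf{CS}}_S$; $\mathcal V^c_S(p):=|p|^{\mathsf{CS}}_S$. An $\mathsf{RPLJ}_{\mathsf{CS}}$-model is $(\mathcal W,\mathcal R,\mathcal E,\mathcal V)$ with $\mathcal W\ne\emptyset$, $\mathcal R\subseteq\mathcal W^2$, $\mathcal V:\mathcal W\times\mathcal P\to[0,1]$, and $\mathcal E:\mathcal W\times Tm\times Fm\to[0,1]$ satisfying the three conditions in the claim at every world. -}

module Defs where

open import Data.Nat using (ℕ)
open import Data.Rational using (ℚ; 0ℚ; 1ℚ; _+_; _-_; _⊔_; _⊓_; _≤_; _<_)
open import Data.Product using (Σ; ∃; _×_; _,_)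
open import Data.Sum using (_⊎_)
open import Relation.Nullary using (¬_)
open import Relation.Binary.PropositionalEquality using (_≡_)
open import Data.Rational.Properties using (≤-refl; _≤?_)
open import Relation.Nullary.Decidable using (toWitness)
open import Data.Unit using (tt)

-- Łukasiewicz operations on rationals (restricted to [0,1] in use)

_*L_ : ℚ → ℚ → ℚ
x *L y = 0ℚ ⊔ ((x + y) - 1ℚ)

_⇒L_ : ℚ → ℚ → ℚ
x ⇒L y = 1ℚ ⊓ ((1ℚ - x) + y)

record Q01 : Set where
  constructor q01
  field
    val : ℚ
    .lo : 0ℚ ≤ val
    .hi : val ≤ 1ℚ
open Q01 public

data Tm : Set where
  jvar  : ℕ → Tm
  jcon  : ℕ → Tm
  _·_   : Tm → Tm → Tm
  _⊕_   : Tm → Tm → Tm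

infixr 5 _⇒_
infixl 6 _&_
infix 7 _∶_

data Fm : Set where
  pv   : ℕ → Fm
  cst  : Q01 → Fm
  _&_  : Fm → Fm → Fm
  _⇒_  : Fm → Fm → Fm
  _∶_  : Tm → Fm → Fm

0≤1 : 0ℚ ≤ 1ℚ
0≤1 = toWitness {a? = 0ℚ ≤? 1ℚ} tt

q0 q1 : Q01
q0 = q01 0ℚ ≤-refl 0≤1
q1 = q01 1ℚ 0≤1 ≤-refl

bar0 : Fm
bar0 = cst q0

¬' : Fm → Fm
¬' A = A ⇒ bar0

_∧_ : Fm → Fm → Fm
A ∧ B = A & (A ⇒ B)

_≡F_ : Fm → Fm → Fm
A ≡F B = (A ⇒ B) & (B ⇒ A)

_∶[_]_ : Tm → Q01 → Fm → Fm
t ∶[ r ] A = (cst r ⇒ t ∶ A) ∧ (t ∶ A ⇒ cst r)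

data Axiom : Fm → Set where
  BL1  : ∀ A B C → Axiom ((A ⇒ B) ⇒ ((B ⇒ C) ⇒ (A ⇒ C)))
  BL2  : ∀ A B → Axiom ((A & B) ⇒ A)
  BL3  : ∀ A B → Axiom ((A & B) ⇒ (B & A))
  BL4  : ∀ A B → Axiom ((A & (A ⇒ B)) ⇒ (B & (B ⇒ A)))
  BL5a : ∀ A B C → Axiom ((A ⇒ (B ⇒ C)) ⇒ ((A & B) ⇒ C))
  BL5b : ∀ A B C → Axiom (((A & B) ⇒ C) ⇒ (A ⇒ (B ⇒ C)))
  BL6  : ∀ A B C → Axiom (((A ⇒ B) ⇒ C) ⇒ (((B ⇒ A) ⇒ C) ⇒ C))
  BL7  : ∀ A → Axiom (bar0 ⇒ A)
  Ł    : ∀ A → Axiom (¬' (¬' A) ⇒ A)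
  TC1  : ∀ r r' s → val s ≡ (val r ⇒L val r') →
         Axiom ((cst r ⇒ cst r') ≡F cst s)
  TC2  : ∀ r r' s → val s ≡ (val r *L val r') →
         Axiom ((cst r & cst r') ≡F cst s)
  Appl : ∀ s t A B → Axiom ((s ∶ (A ⇒ B)) ⇒ ((t ∶ A) ⇒ ((s · t) ∶ B)))
  Sum1 : ∀ s t A → Axiom ((s ∶ A) ⇒ ((s ⊕ t) ∶ A))
  Sum2 : ∀ s t A → Axiom ((s ∶ A) ⇒ ((t ⊕ s) ∶ A))

data IterCS : Fm → Set where
  base : ∀ {A} (c : ℕ) → Axiom A → IterCS (jcon c ∶[ q1 ] A)
  step : ∀ {F} (c : ℕ) → IterCS F → IterCS (jcon c ∶[ q1 ] F)

record IsCS (CS : Fm → Set) : Set where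
  field
    shape    : ∀ F → CS F → IterCS F
    downward : ∀ c F → CS (jcon c ∶[ q1 ] F) → IterCS F → CS F

data _⊢[_]_ (S : Fm → Set) (CS : Fm → Set) : Fm → Set where
  ax   : ∀ {A} → Axiom A → S ⊢[ CS ] A
  prem : ∀ {A} → S A → S ⊢[ CS ] A
  csr  : ∀ {A} → CS A → S ⊢[ CS ] A
  mp   : ∀ {A B} → S ⊢[ CS ] A → S ⊢[ CS ] (A ⇒ B) → S ⊢[ CS ] B

Consistent : (CS S : Fm → Set) → Set
Consistent CS S = ¬ (S ⊢[ CS ] bar0)

Complete : (CS S : Fm → Set) → Set
Complete CS S = ∀ A B → (S ⊢[ CS ] (A ⇒ B)) ⊎ (S ⊢[ CS ] (B ⇒ A))

World : (CS : Fm → Set) → (S : Fm → Set) → Set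
World CS S = Consistent CS S × Complete CS S

-- Provability degree  |A|_S = sup DegSet S A  (a supremum of rationals,
-- represented by the set whose sup it is, since there are no reals)

DegSet : (CS S : Fm → Set) → Fm → Q01 → Set
DegSet CS S A r = S ⊢[ CS ] (cst r ⇒ A)

Ec : (CS S : Fm → Set) → Tm → Fm → Q01 → Set
Ec CS S t A = DegSet CS S (t ∶ A)

-- real-valued comparisons of suprema, written over rationals:
-- sup X ≤ sup Y   iff  every x ∈ X and rational q < x has some y ∈ Y with q ≤ y
_≤sup_ : (Q01 → Set) → (Q01 → Set) → Set
X ≤sup Y = ∀ x → X x → ∀ (q : ℚ) → q < val x → Σ Q01 λ y → Y y × (q ≤ val y)

-- the set {x *L y : x ∈ X, y ∈ Y}; its sup is sup X *L sup Y
-- (since *L is continuous and monotone on [0,1])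
_⊛_ : (Q01 → Set) → (Q01 → Set) → Q01 → Set
(X ⊛ Y) z = Σ Q01 λ x → Σ Q01 λ y → X x × Y y × (val z ≡ (val x *L val y))

-- sup X = 1  (given sup X ≤ 1 always):  1 ≤ sup X
SupIsOne : (Q01 → Set) → Set
SupIsOne X = ∀ (q : ℚ) → q < 1ℚ → Σ Q01 λ y → X y × (q ≤ val y)

{-# OPTIONS --safe #-}
-- Each inequality between provability degrees is witnessed degree by degree.
-- If r̄ → s:(A → B) and r̄' → t:A are derivable, then (Appl) gives
-- r̄ → (r̄' → (s·t):B), hence r̄ & r̄' → (s·t):B, and (TC2) turns r̄ & r̄'
-- into the truth constant of r *L r'. The (Sum) axioms transport every
-- lower bound of s:A to t+s:A and s+t:A, and a member c :¹ F of CS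
-- yields 1̄ → c:F outright.
module Submission where

open import Defs
open import Data.Nat using (ℕ)
open import Data.Product using (_×_; _,_)
open import Data.Rational.Properties using (<⇒≤)
open import Relation.Unary using (Pred; _⊆_)
open import Level using (0ℓ)
open import Relation.Binary.PropositionalEquality using (_≡_)

module _ {CS S : Fm → Set} where

  &-proj₁ : ∀ {A B} → S ⊢[ CS ] (A & B) → S ⊢[ CS ] A
  &-proj₁ p = mp p (ax (BL2 _ _))

  &-proj₂ : ∀ {A B} → S ⊢[ CS ] (A & B) → S ⊢[ CS ] B
  &-proj₂ p = &-proj₁ (mp p (ax (BL3 _ _)))

  ⇒-trans : ∀ {A B C} → S ⊢[ CS ] (A ⇒ B) → S ⊢[ CS ] (B ⇒ C) → S ⊢[ CS ] (A ⇒ C)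
  ⇒-trans f g = mp g (mp f (ax (BL1 _ _ _)))

  ⇒-antimonoˡ : ∀ {A A′ C} → S ⊢[ CS ] (A′ ⇒ A) → S ⊢[ CS ] ((A ⇒ C) ⇒ (A′ ⇒ C))
  ⇒-antimonoˡ f = mp f (ax (BL1 _ _ _))

  ⇒-uncurry : ∀ {A B C} → S ⊢[ CS ] (A ⇒ (B ⇒ C)) → S ⊢[ CS ] ((A & B) ⇒ C)
  ⇒-uncurry f = mp f (ax (BL5a _ _ _))

  cst-*L⇒& : ∀ {x y z} → val z ≡ val x *L val y → S ⊢[ CS ] (cst z ⇒ (cst x & cst y))
  cst-*L⇒& {x} {y} {z} z≡x*y = &-proj₂ (ax (TC2 x y z z≡x*y))

  DegSet-mono : ∀ {A B} → S ⊢[ CS ] (A ⇒ B) → DegSet CS S A ⊆ DegSet CS S B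
  DegSet-mono f r≤A = ⇒-trans r≤A f

  ⊛-DegSet : ∀ {A B C} → S ⊢[ CS ] (A ⇒ (B ⇒ C)) →
             (DegSet CS S A ⊛ DegSet CS S B) ⊆ DegSet CS S C
  ⊛-DegSet f (_ , _ , x≤A , y≤B , z≡x*y) =
    ⇒-trans (cst-*L⇒& z≡x*y)
            (⇒-uncurry (⇒-trans (⇒-trans x≤A f) (⇒-antimonoˡ y≤B)))

⊆⇒≤sup : {X Y : Pred Q01 0ℓ} → X ⊆ Y → X ≤sup Y
⊆⇒≤sup X⊆Y x x∈X q q<x = x , X⊆Y x∈X , <⇒≤ q<x

q1∈⇒SupIsOne : {X : Pred Q01 0ℓ} → X q1 → SupIsOne X
q1∈⇒SupIsOne q1∈X q q<1 = q1 , q1∈X , <⇒≤ q<1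

lemma13 : (CS : Fm → Set) → IsCS CS →
    (S : Fm → Set) → World CS S →
    (∀ (s t : Tm) (A B : Fm) →
        (Ec CS S s (A ⇒ B) ⊛ Ec CS S t A) ≤sup Ec CS S (s · t) B)
    × (∀ (s t : Tm) (A : Fm) →
        (Ec CS S s A ≤sup Ec CS S (t ⊕ s) A)
        × (Ec CS S s A ≤sup Ec CS S (s ⊕ t) A))
    × (∀ (c : ℕ) (F : Fm) → CS (jcon c ∶[ q1 ] F) →
        SupIsOne (Ec CS S (jcon c) F))
lemma13 CS _ S _ = appl , sum , constant
  where
  appl : ∀ s t A B → (Ec CS S s (A ⇒ B) ⊛ Ec CS S t A) ≤sup Ec CS S (s · t) B
  appl s t A B = ⊆⇒≤sup (⊛-DegSet (ax (Appl s t A B)))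

  sum : ∀ s t A → (Ec CS S s A ≤sup Ec CS S (t ⊕ s) A) × (Ec CS S s A ≤sup Ec CS S (s ⊕ t) A)
  sum s t A = ⊆⇒≤sup (DegSet-mono (ax (Sum2 s t A))) , ⊆⇒≤sup (DegSet-mono (ax (Sum1 s t A)))

  constant : ∀ c F → CS (jcon c ∶[ q1 ] F) → SupIsOne (Ec CS S (jcon c) F)
  constant c F c∶F∈CS = q1∈⇒SupIsOne (&-proj₁ (csr c∶F∈CS))
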